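{- Let $r\ge 1$ be an integer. In the $r$-central routing problem on the infinite square grid (store-and-forward $\Delta$-port model), every schedule delivering all packets needs at least $\binom{r+1}{2}$ steps.
   Context: Square grid: the infinite graph on $\mathbb{Z}^2$ with $(x,y)$ adjacent to $(x\pm1,y)$ and $(x,y\pm1)$. $r$-central routing: a central node $v$ is fixed and every node at distance between $1$ and $r$ from $v$ holds exactly one packet whose destination is $v$. Routing model: time proceeds in synchronous steps; in each step each packet either stays at its current node (unbounded queues) or moves along one incident edge; a node may use all its incident edges simultaneously; each edge can be traversed by at most one packet per step in each direction (full-duplex). The running time is the number of steps until all packets have reached their destination. -}

module Defs where

open import Data.Nat using (ℕ; suc; _+_; _≤_; _<_)
open import Data.Integer as ℤ using (ℤ; ∣_∣; _-_)
open import Data.Product using (Σ; _×_; _,_; proj₁; ∃-syntax)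
open import Data.Sum using (_⊎_)
open import Relation.Binary.PropositionalEquality using (_≡_; _≢_)

Node : Set
Node = ℤ × ℤ

dist : Node → Node → ℕ
dist (x₁ , y₁) (x₂ , y₂) = ∣ x₁ - x₂ ∣ + ∣ y₁ - y₂ ∣

Adj : Node → Node → Set
Adj a b = dist a b ≡ 1

-- Packets of the r-central routing instance with centre v:
-- one packet for each node u with 1 ≤ dist u v ≤ r (its origin).
Packet : (r : ℕ) (v : Node) → Set
Packet r v = Σ Node (λ u → (1 ≤ dist u v) × (dist u v ≤ r))

origin : ∀ {r v} → Packet r v → Node
origin = proj₁

-- A schedule running for T steps in the store-and-forward, all-port,
-- full-duplex model: pos p t is the node where packet p is at time t.
-- Each step a packet stays or moves along one edge; each directed edge is
-- used by at most one packet per step; every packet reaches v by time T.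
record Schedule (r : ℕ) (v : Node) (T : ℕ) : Set where
  field
    pos       : Packet r v → ℕ → Node
    start     : ∀ p → pos p 0 ≡ origin p
    move      : ∀ p t → t < T → (pos p (suc t) ≡ pos p t) ⊎ Adj (pos p t) (pos p (suc t))
    capacity  : ∀ p q t → t < T →
                pos p t ≡ pos q t → pos p (suc t) ≡ pos q (suc t) →
                pos p t ≢ pos p (suc t) → origin p ≡ origin q
    delivered : ∀ p → ∃[ t ] (t ≤ T × pos p t ≡ v)

module Submission where

-- Idea (a counting argument on the last hop of every packet).  A packet
-- enters the centre v in its final step, coming from one of the four
-- neighbours v + e, e a unit vector.  By the capacity constraint the directed
-- edge (v + e → v) carries at most one packet per step, so a packet is
-- determined (up to its origin) by its arrival slot (time < T, direction e):
-- there are at most 4T packets.  On the other hand the punctured ball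
-- 1 ≤ |u - v|₁ ≤ r contains 4 · (1 + 2 + ⋯ + r) grid points, each the origin
-- of a packet.  Hence 4 · Tri r ≤ 4 · T, i.e. C(r+1,2) ≤ T.

open import Defs
open import Data.Nat using (ℕ; _+_; _≤_)
open import Data.Nat.Combinatorics using (_C_)

open import Data.Nat using (zero; suc; _<_; _∸_; _*_; s≤s; z≤n)
import Data.Nat.Properties as ℕP
open import Data.Nat.Combinatorics using (nC1≡n; nCk+nC[k+1]≡[n+1]C[k+1])
open import Data.Integer as ℤ using (+_; -[1+_]; ∣_∣)
import Data.Integer.Properties as ℤP
open import Algebra.Properties.AbelianGroup ℤP.+-0-abelianGroup using (xyx⁻¹≈y; ∙-cancelʳ)
open import Data.Fin as Fin using (Fin; splitAt; join; combine; remQuot; toℕ; fromℕ<)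
import Data.Fin.Properties as FinP
open import Data.Product using (_×_; _,_; proj₁; proj₂; ∃-syntax; uncurry)
open import Data.Product.Properties using (≡-dec)
open import Data.Sum using (inj₁; inj₂)
open import Data.Empty using (⊥-elim)
open import Relation.Nullary using (Dec; yes; no; ¬_)
open import Relation.Binary.PropositionalEquality

_≟ₙ_ : (a b : Node) → Dec (a ≡ b)
_≟ₙ_ = ≡-dec ℤP._≟_ ℤP._≟_

_⊕_ : Node → Node → Node
(x , y) ⊕ (a , b) = (x ℤ.+ a , y ℤ.+ b)

disp : Node → Node → Node
disp (x₁ , y₁) (x₂ , y₂) = (x₁ ℤ.- x₂ , y₁ ℤ.- y₂)

norm : Node → ℕ
norm (x , y) = ∣ x ∣ + ∣ y ∣

disp-⊕ : ∀ v o → disp (v ⊕ o) v ≡ o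
disp-⊕ (x , y) (a , b) = cong₂ _,_ (xyx⁻¹≈y x a) (xyx⁻¹≈y y b)

disp-injective : ∀ w w′ v → disp w v ≡ disp w′ v → w ≡ w′
disp-injective (x , y) (x′ , y′) (a , b) e =
  cong₂ _,_ (∙-cancelʳ (ℤ.- a) x x′ (cong proj₁ e)) (∙-cancelʳ (ℤ.- b) y y′ (cong proj₂ e))

dist-self : ∀ v → dist v v ≡ 0
dist-self (x , y) = cong₂ _+_ (cong ∣_∣ (ℤP.+-inverseʳ x)) (cong ∣_∣ (ℤP.+-inverseʳ y))

-- The four directions, indexed by Fin 4 so that arrival slots can be counted.
Dir : Set
Dir = Fin 4

pattern east  = Fin.zero
pattern north = Fin.suc Fin.zero
pattern west  = Fin.suc (Fin.suc Fin.zero)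
pattern south = Fin.suc (Fin.suc (Fin.suc Fin.zero))

unit : Dir → Node
unit east  = (+ 1 , + 0)
unit north = (+ 0 , + 1)
unit west  = (-[1+ 0 ] , + 0)
unit south = (+ 0 , -[1+ 0 ])

unit-vector : ∀ o → norm o ≡ 1 → ∃[ d ] o ≡ unit d
unit-vector (+ 0 , + 1)            _ = north , refl
unit-vector (+ 0 , -[1+ 0 ])       _ = south , refl
unit-vector (+ 1 , + 0)            _ = east , refl
unit-vector (-[1+ 0 ] , + 0)       _ = west , refl
unit-vector (+ 0 , + 0)            ()
unit-vector (+ 0 , + suc (suc _))  ()
unit-vector (+ 0 , -[1+ suc _ ])   ()
unit-vector (+ 1 , + suc _)        ()
unit-vector (+ 1 , -[1+ _ ])       ()
unit-vector (+ suc (suc _) , _)    ()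
unit-vector (-[1+ 0 ] , + suc _)   ()
unit-vector (-[1+ 0 ] , -[1+ _ ])  ()
unit-vector (-[1+ suc _ ] , _)     ()

enteringStep : ∀ {ℓ} {P : ℕ → Set ℓ} → (∀ t → Dec (P t)) → ¬ P 0 →
               ∀ t → P t → ∃[ t′ ] (t′ < t × ¬ P t′ × P (suc t′))
enteringStep P? ¬P₀ zero P₀ = ⊥-elim (¬P₀ P₀)
enteringStep P? ¬P₀ (suc t) Pₜ₊₁ with P? t
... | no ¬Pₜ = t , ℕP.n<1+n t , ¬Pₜ , Pₜ₊₁
... | yes Pₜ with enteringStep P? ¬P₀ t Pₜ
...   | t′ , t′<t , ¬Pₜ′ , Pₜ′₊₁ = t′ , ℕP.m<n⇒m<1+n t′<t , ¬Pₜ′ , Pₜ′₊₁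

origin≢centre : ∀ {r v} (p : Packet r v) → origin p ≢ v
origin≢centre {v = v} (u , 1≤d , _) refl = ℕP.<-irrefl (sym (dist-self v)) 1≤d

module _ {r : ℕ} {v : Node} {T : ℕ} (S : Schedule r v T) where
  open Schedule S

  record FinalStep (p : Packet r v) : Set where
    field
      time   : ℕ
      early  : time < T
      dir    : Dir
      before : disp (pos p time) v ≡ unit dir
      after  : pos p (suc time) ≡ v
      moves  : pos p time ≢ pos p (suc time)

  -- Every packet has a final step: the last time it is away from v before
  -- delivery, followed by a move along an edge into v.
  finalStep : ∀ p → FinalStep p
  finalStep p with delivered p
  ... | t₀ , t₀≤T , atV
    with enteringStep (λ t → pos p t ≟ₙ v) (λ e → origin≢centre p (trans (sym (start p)) e)) t₀ atV
  ... | t , t<t₀ , away , arrived with move p t (ℕP.<-≤-trans t<t₀ t₀≤T)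
  ...   | inj₁ stays = ⊥-elim (away (trans (sym stays) arrived))
  ...   | inj₂ adj with unit-vector (disp (pos p t) v) (subst (λ w → dist (pos p t) w ≡ 1) arrived adj)
  ...     | d , onEdge = record
    { time = t ; early = ℕP.<-≤-trans t<t₀ t₀≤T ; dir = d ; before = onEdge
    ; after = arrived ; moves = λ e → away (trans e arrived) }

  -- Capacity: two packets entering v at the same step from the same
  -- direction use the same directed edge, hence are the same packet.
  sameSlot⇒sameOrigin : ∀ {p q} (s : FinalStep p) (s′ : FinalStep q) →
                        FinalStep.time s ≡ FinalStep.time s′ → FinalStep.dir s ≡ FinalStep.dir s′ →
                        origin p ≡ origin q
  sameSlot⇒sameOrigin {p} {q} s s′ sameTime sameDir =
    capacity p q t (early s) sameSource sameTarget (moves s)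
    where
    open FinalStep
    t = time s
    sameSource : pos p t ≡ pos q t
    sameSource = disp-injective _ _ v
      (trans (before s) (trans (cong unit sameDir)
        (sym (subst (λ t′ → disp (pos q t′) v ≡ unit (dir s′)) (sym sameTime) (before s′)))))
    sameTarget : pos p (suc t) ≡ pos q (suc t)
    sameTarget = trans (after s) (sym (subst (λ t′ → pos q (suc t′) ≡ v) (sym sameTime) (after s′)))

  arrivalSlot : Packet r v → Fin (T * 4)
  arrivalSlot p = combine (fromℕ< early) dir
    where open FinalStep (finalStep p)

  arrivalSlot-injective : ∀ p q → arrivalSlot p ≡ arrivalSlot q → origin p ≡ origin q
  arrivalSlot-injective p q e = sameSlot⇒sameOrigin s s′
    (FinP.fromℕ<-injective _ _ (early s) (early s′)
      (FinP.combine-injectiveˡ (fromℕ< (early s)) (dir s) (fromℕ< (early s′)) (dir s′) e))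
    (FinP.combine-injectiveʳ (fromℕ< (early s)) (dir s) (fromℕ< (early s′)) (dir s′) e)
    where
    open FinalStep
    s = finalStep p
    s′ = finalStep q

-- Tri s = 1 + 2 + ⋯ + s, the number of pairs (l , n) with n ≤ l < s.
Tri : ℕ → ℕ
Tri zero = 0
Tri (suc s) = suc s + Tri s

-- Pascal's rule turns the recursion for Tri into the binomial coefficient.
Tri≡C : ∀ s → Tri s ≡ (s + 1) C 2
Tri≡C zero = refl
Tri≡C (suc s) = begin
  suc s + Tri s         ≡⟨ cong₂ _+_ (sym (nC1≡n (suc s))) (trans (Tri≡C s) (cong (_C 2) (ℕP.+-comm s 1))) ⟩
  suc s C 1 + suc s C 2 ≡⟨ nCk+nC[k+1]≡[n+1]C[k+1] (suc s) 1 ⟩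
  suc (suc s) C 2       ≡⟨ cong (_C 2) (ℕP.+-comm 1 (suc s)) ⟩
  (suc s + 1) C 2       ∎
  where open ≡-Reasoning

-- Fin (Tri s) enumerates the pairs (l , n) with n ≤ l < s: its first s
-- elements form the row l = s - 1, the rest enumerate the pairs for s - 1.
triangle : (s : ℕ) → Fin (Tri s) → ℕ × ℕ
triangle (suc s) i with splitAt (suc s) i
... | inj₁ n = s , toℕ n
... | inj₂ j = triangle s j

triangle-bounds : ∀ s i → proj₂ (triangle s i) ≤ proj₁ (triangle s i) × proj₁ (triangle s i) < s
triangle-bounds (suc s) i with splitAt (suc s) i
... | inj₁ n = ℕP.≤-pred (FinP.toℕ<n n) , ℕP.n<1+n s
... | inj₂ j with triangle-bounds s j
...   | n≤l , l<s = n≤l , ℕP.m<n⇒m<1+n l<s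

splitAt-injective : ∀ m {n} (i j : Fin (m + n)) → splitAt m i ≡ splitAt m j → i ≡ j
splitAt-injective m {n} i j e =
  trans (sym (FinP.join-splitAt m n i)) (trans (cong (join m n) e) (FinP.join-splitAt m n j))

-- Distinct rows have distinct first components, so the enumeration is injective.
triangle-injective : ∀ s i j → triangle s i ≡ triangle s j → i ≡ j
triangle-injective (suc s) i j e with splitAt (suc s) i in eqi | splitAt (suc s) j in eqj
... | inj₁ n | inj₁ n′ = splitAt-injective (suc s) i j
  (trans eqi (trans (cong inj₁ (FinP.toℕ-injective (cong proj₂ e))) (sym eqj)))
... | inj₁ _ | inj₂ j′ = ⊥-elim (ℕP.<-irrefl (sym (cong proj₁ e)) (proj₂ (triangle-bounds s j′)))
... | inj₂ i′ | inj₁ _ = ⊥-elim (ℕP.<-irrefl (cong proj₁ e) (proj₂ (triangle-bounds s i′)))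
... | inj₂ i′ | inj₂ j′ = splitAt-injective (suc s) i j
  (trans eqi (trans (cong inj₂ (triangle-injective s i′ j′ e)) (sym eqj)))

-- The point at distance 1 + m + n in quadrant d: start 1 + m units along the
-- axis of d and go n units towards the next axis (counterclockwise).
sector : Dir → ℕ → ℕ → Node
sector east  m n = (+ suc m , + n)
sector north m n = (ℤ.- (+ n) , + suc m)
sector west  m n = (-[1+ m ] , ℤ.- (+ n))
sector south m n = (+ n , -[1+ m ])

norm-sector : ∀ d m n → norm (sector d m n) ≡ suc (m + n)
norm-sector east  m n = refl
norm-sector north m n = trans (cong (_+ suc m) (ℤP.∣-i∣≡∣i∣ (+ n))) (ℕP.+-comm n (suc m))
norm-sector west  m n = cong (λ k → suc m + k) (ℤP.∣-i∣≡∣i∣ (+ n))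
norm-sector south m n = ℕP.+-comm n (suc m)

neg≢pos : ∀ n m → ℤ.- (+ n) ≢ + suc m
neg≢pos zero    m ()
neg≢pos (suc n) m ()

neg-+-injective : ∀ {n n′} → ℤ.- (+ n) ≡ ℤ.- (+ n′) → n ≡ n′
neg-+-injective e = ℤP.+-injective (ℤP.neg-injective e)

sector-injective : ∀ {d m n d′ m′ n′} → sector d m n ≡ sector d′ m′ n′ →
                   d ≡ d′ × m ≡ m′ × n ≡ n′
sector-injective {d} {m} {n} {d′} {m′} {n′} e = compare d d′ (cong proj₁ e) (cong proj₂ e)
  where
  compare : ∀ d d′ → proj₁ (sector d m n) ≡ proj₁ (sector d′ m′ n′) →
            proj₂ (sector d m n) ≡ proj₂ (sector d′ m′ n′) → d ≡ d′ × m ≡ m′ × n ≡ n′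
  compare east  east  refl refl = refl , refl , refl
  compare east  north ex   _    = ⊥-elim (neg≢pos n′ m (sym ex))
  compare east  west  ()   _
  compare east  south _    ()
  compare north east  ex   _    = ⊥-elim (neg≢pos n m′ ex)
  compare north north ex   refl = refl , refl , neg-+-injective ex
  compare north west  _    ey   = ⊥-elim (neg≢pos n′ m (sym ey))
  compare north south _    ()
  compare west  east  ()   _
  compare west  north _    ey   = ⊥-elim (neg≢pos n m′ ey)
  compare west  west  refl ey   = refl , refl , neg-+-injective ey
  compare west  south ()   _
  compare south east  _    ()
  compare south north _    ()
  compare south west  ()   _
  compare south south refl refl = refl , refl , refl

-- The offset of index (d , i): the point of ring 1 + l in quadrant d at
-- position n, where (l , n) = triangle r i.
ballOffset : (r : ℕ) → Dir × Fin (Tri r) → Node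
ballOffset r (d , i) = sector d (l ∸ n) n
  where
  l = proj₁ (triangle r i)
  n = proj₂ (triangle r i)

norm-ballOffset : ∀ r d i → norm (ballOffset r (d , i)) ≡ suc (proj₁ (triangle r i))
norm-ballOffset r d i =
  trans (norm-sector d _ _) (cong suc (ℕP.m∸n+n≡m (proj₁ (triangle-bounds r i))))

-- Distinct indices give distinct offsets: quadrant, gap l - n and position n
-- determine the index.
ballOffset-injective : ∀ r x y → ballOffset r x ≡ ballOffset r y → x ≡ y
ballOffset-injective r (d , i) (d′ , j) e with sector-injective e
... | refl , sameGap , samePos = cong (d ,_) (triangle-injective r i j (cong₂ _,_ sameRing samePos))
  where
  sameRing : proj₁ (triangle r i) ≡ proj₁ (triangle r j)
  sameRing = trans (sym (ℕP.m∸n+n≡m (proj₁ (triangle-bounds r i))))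
               (trans (cong₂ _+_ sameGap samePos) (ℕP.m∸n+n≡m (proj₁ (triangle-bounds r j))))

ballPacket : (r : ℕ) (v : Node) → Dir × Fin (Tri r) → Packet r v
ballPacket r v x@(d , i) =
  v ⊕ ballOffset r x , subst (1 ≤_) (sym distance) (s≤s z≤n) , subst (_≤ r) (sym distance) (proj₂ (triangle-bounds r i))
  where
  distance : dist (v ⊕ ballOffset r x) v ≡ suc (proj₁ (triangle r i))
  distance = trans (cong norm (disp-⊕ v (ballOffset r x))) (norm-ballOffset r d i)

ballPacket-injective : ∀ r v x y → origin (ballPacket r v x) ≡ origin (ballPacket r v y) → x ≡ y
ballPacket-injective r v x y e = ballOffset-injective r x y
  (trans (sym (disp-⊕ v (ballOffset r x))) (trans (cong (λ w → disp w v) e) (disp-⊕ v (ballOffset r y))))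

remQuot-injective : ∀ {m} n (i j : Fin (m * n)) → remQuot {m} n i ≡ remQuot n j → i ≡ j
remQuot-injective {m} n i j e =
  trans (sym (FinP.combine-remQuot {m} n i)) (trans (cong (uncurry (combine {m} {n})) e) (FinP.combine-remQuot {m} n j))

-- The 4 · Tri r ball packets have pairwise distinct arrival slots among the
-- T · 4 available ones.
mainTheorem4 : (r : ℕ) → 1 ≤ r → (v : Node) → (T : ℕ) →
               Schedule r v T → ((r + 1) C 2) ≤ T
mainTheorem4 r _ v T S = subst (_≤ T) (Tri≡C r) (ℕP.*-cancelʳ-≤ (Tri r) T 4 slotCount)
  where
  index : Fin (4 * Tri r) → Dir × Fin (Tri r)
  index = remQuot {4} (Tri r)

  slotOf : Fin (4 * Tri r) → Fin (T * 4)
  slotOf k = arrivalSlot S (ballPacket r v (index k))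

  slotOf-injective : ∀ {k k′} → slotOf k ≡ slotOf k′ → k ≡ k′
  slotOf-injective {k} {k′} e = remQuot-injective (Tri r) k k′
    (ballPacket-injective r v (index k) (index k′)
      (arrivalSlot-injective S (ballPacket r v (index k)) (ballPacket r v (index k′)) e))

  slotCount : Tri r * 4 ≤ T * 4
  slotCount = subst (_≤ T * 4) (ℕP.*-comm 4 (Tri r)) (FinP.injective⇒≤ {f = slotOf} slotOf-injective)
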